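{- Let $a\in\mathbb{N}$ with $a\geq 4$, and let $(b_2,\ldots,b_{a-1})\in\mathbb{N}^{a-2}$ satisfy $\sum_{i=2}^{a-1}b_if_i\geq f_a$. If either ($b_{a-2}\geq1$ and $b_{a-1}\geq1$) or ($b_{a-2}=0$ and $b_{a-1}\geq 2$), then $\sum_{i=2}^{a-1}b_if_i-f_a=\sum_{i=2}^{a-1}c_if_i$ for some $(c_2,\ldots,c_{a-1})\in\mathbb{N}^{a-2}$ with $\sum_{i=2}^{a-1}c_i<\sum_{i=2}^{a-1}b_i$.
   Context: $\{f_n\}$ is the Fibonacci sequence ($f_0=0$, $f_1=1$, $f_{n+2}=f_{n+1}+f_n$). -}

module Defs where

open import Data.Nat using (ℕ; zero; suc; _+_; _*_)

fib : ℕ → ℕ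
fib zero = 0
fib (suc zero) = 1
fib (suc (suc n)) = fib (suc n) + fib n

-- A tuple (b_2, …, b_{a-1}) ∈ ℕ^{a-2} is represented by a function b : ℕ → ℕ,
-- b i = b_i; only the values at 2 ≤ i ≤ a-1 are ever used.

-- Σ_{i=2}^{a-1} g i   (i.e. Σ over 2 ≤ i < a; empty when a ≤ 2)
Σ₂ : (a : ℕ) → (ℕ → ℕ) → ℕ
Σ₂ zero g = 0
Σ₂ (suc zero) g = 0
Σ₂ (suc (suc zero)) g = 0
Σ₂ (suc (suc (suc m))) g = Σ₂ (suc (suc m)) g + g (suc (suc m))

total : ℕ → (ℕ → ℕ) → ℕ
total a b = Σ₂ a b

fibSum : ℕ → (ℕ → ℕ) → ℕ
fibSum a b = Σ₂ a (λ i → b i * fib i)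

{-# OPTIONS --safe #-}
-- Subtracting f_a from Σ b_i f_i is a local exchange at the top indices.
-- If b_{a-2}, b_{a-1} ≥ 1, remove one copy of f_{a-2} and one of f_{a-1},
-- since f_a = f_{a-1} + f_{a-2}; the count drops by 2. If b_{a-1} ≥ 2, trade
-- two copies of f_{a-1} for one of f_{a-3}, since 2 f_{a-1} = f_a + f_{a-3};
-- the count drops by 1. For a = 4 the index a-3 = 1 lies outside the tuple,
-- but f_1 = f_2, so the new copy goes to index 2 instead.
module Submission where

open import Defs
open import Data.Nat using (ℕ; zero; suc; _+_; _*_; _∸_; _≥_; _<_; _≟_; z<s; s≤s)
open import Data.Nat.Properties
  using (<⇒≢; 1+n≢n; m<n+m; m<n⇒m<1+n; n<1+n; ≤-trans; m≤n+m; m∸n+n≡m; m+n∸n≡m; m<m+n)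
open import Data.Nat.Tactic.RingSolver using (solve-∀)
open import Data.Product using (Σ; _×_; _,_)
open import Data.Sum using (_⊎_; inj₁; inj₂)
open import Relation.Nullary using (yes; no; contradiction)
open import Relation.Binary.PropositionalEquality
  using (_≡_; _≢_; refl; sym; trans; cong; cong₂; subst; module ≡-Reasoning)
open ≡-Reasoning

update : (ℕ → ℕ) → ℕ → ℕ → ℕ → ℕ
update b k v i with i ≟ k
... | yes _ = v
... | no  _ = b i

update-same : ∀ b k v → update b k v k ≡ v
update-same b k v with k ≟ k
... | yes _   = refl
... | no  k≢k = contradiction refl k≢k

update-≢ : ∀ b v {k i} → i ≢ k → update b k v i ≡ b i
update-≢ b v {k} {i} i≢k with i ≟ k
... | yes i≡k = contradiction i≡k i≢k
... | no  _   = refl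

update-< : ∀ b v {k i} → i < k → update b k v i ≡ b i
update-< b v i<k = update-≢ b v (<⇒≢ i<k)

Σ₂-cong : ∀ n {g h : ℕ → ℕ} → (∀ {i} → i < n → g i ≡ h i) → Σ₂ n g ≡ Σ₂ n h
Σ₂-cong zero                _   = refl
Σ₂-cong (suc zero)          _   = refl
Σ₂-cong (suc (suc zero))    _   = refl
Σ₂-cong (suc (suc (suc m))) g≡h =
  cong₂ _+_ (Σ₂-cong (suc (suc m)) (λ i<n → g≡h (m<n⇒m<1+n i<n))) (g≡h (n<1+n _))

fibSum-cong : ∀ n {b c : ℕ → ℕ} → (∀ {i} → i < n → b i ≡ c i) → fibSum n b ≡ fibSum n c
fibSum-cong n b≡c = Σ₂-cong n (λ {i} i<n → cong (_* fib i) (b≡c i<n))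

record Reduction (a : ℕ) (b : ℕ → ℕ) : Set where
  field
    c        : ℕ → ℕ
    fibSum-≡ : fibSum a b ≡ fibSum a c + fib a
    total-<  : total a c < total a b

<-+-suc : ∀ {x y} d → x ≡ y + suc d → y < x
<-+-suc {y = y} d x≡y+1+d = subst (y <_) (sym x≡y+1+d) (m<m+n y z<s)

remove-two : ∀ s x y p q → s + (x + 1) * p + (y + 1) * q ≡ s + x * p + y * q + (q + p)
remove-two = solve-∀

remove-two-count : ∀ t x y → t + (x + 1) + (y + 1) ≡ t + x + y + 2
remove-two-count = solve-∀

-- p, q, q + p stand for f_{j}, f_{j+1}, f_{j+2}, so the subtracted
-- q + p + q is f_{j+3}: the identity is 2 f_{j+2} = f_{j+3} + f_j.
trade-two-for-one : ∀ s x z y p q →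
  s + x * p + z * q + (y + 2) * (q + p) ≡ s + (x + 1) * p + z * q + y * (q + p) + (q + p + q)
trade-two-for-one = solve-∀

trade-two-for-one-count : ∀ t x z y → t + x + z + (y + 2) ≡ t + (x + 1) + z + y + 1
trade-two-for-one-count = solve-∀

trade-two-for-one₄ : ∀ x y → x * 1 + (y + 2) * 2 ≡ (x + 1) * 1 + y * 2 + 3
trade-two-for-one₄ = solve-∀

trade-two-for-one₄-count : ∀ x y → x + (y + 2) ≡ (x + 1) + y + 1
trade-two-for-one₄-count = solve-∀

reduction-pair : ∀ m (b : ℕ → ℕ) → b (2 + m) ≥ 1 → b (3 + m) ≥ 1 → Reduction (4 + m) b
reduction-pair m b bₖ≥1 bₖ₊₁≥1 = record
  { c = c ; fibSum-≡ = fibSum-≡ ; total-< = <-+-suc 1 total-≡ }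
  where
  k = 2 + m
  c = update (update b k (b k ∸ 1)) (suc k) (b (suc k) ∸ 1)

  below : ∀ {i} → i < k → b i ≡ c i
  below i<k = sym (trans (update-< _ _ (m<n⇒m<1+n i<k)) (update-< b _ i<k))

  bₖ : b k ≡ c k + 1
  bₖ = trans (sym (m∸n+n≡m bₖ≥1))
             (cong (_+ 1) (sym (trans (update-< _ _ (n<1+n k)) (update-same b k _))))

  bₖ₊₁ : b (suc k) ≡ c (suc k) + 1
  bₖ₊₁ = trans (sym (m∸n+n≡m bₖ₊₁≥1)) (cong (_+ 1) (sym (update-same _ (suc k) _)))

  fibSum-≡ : fibSum (4 + m) b ≡ fibSum (4 + m) c + fib (4 + m)
  fibSum-≡ = begin
    fibSum k b + b k * fib k + b (suc k) * fib (suc k)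
      ≡⟨ cong₂ _+_ (cong₂ _+_ (fibSum-cong k below) (cong (_* fib k) bₖ))
                   (cong (_* fib (suc k)) bₖ₊₁) ⟩
    fibSum k c + (c k + 1) * fib k + (c (suc k) + 1) * fib (suc k)
      ≡⟨ remove-two (fibSum k c) (c k) (c (suc k)) (fib k) (fib (suc k)) ⟩
    fibSum k c + c k * fib k + c (suc k) * fib (suc k) + (fib (suc k) + fib k)
      ∎

  total-≡ : total (4 + m) b ≡ total (4 + m) c + 2
  total-≡ = begin
    total k b + b k + b (suc k)
      ≡⟨ cong₂ _+_ (cong₂ _+_ (Σ₂-cong k below) bₖ) bₖ₊₁ ⟩
    total k c + (c k + 1) + (c (suc k) + 1)
      ≡⟨ remove-two-count (total k c) (c k) (c (suc k)) ⟩
    total k c + c k + c (suc k) + 2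
      ∎

reduction-double : ∀ m (b : ℕ → ℕ) → b (4 + m) ≥ 2 → Reduction (5 + m) b
reduction-double m b bⱼ₊₂≥2 = record
  { c = c ; fibSum-≡ = fibSum-≡ ; total-< = <-+-suc 0 total-≡ }
  where
  j = 2 + m
  b⁺ = update b j (b j + 1)
  c = update b⁺ (2 + j) (b (2 + j) ∸ 2)

  below : ∀ {i} → i < j → b i ≡ c i
  below i<j = sym (trans (update-< b⁺ _ (≤-trans i<j (m≤n+m j 2))) (update-< b _ i<j))

  cⱼ : c j ≡ b j + 1
  cⱼ = trans (update-< b⁺ _ (m<n+m j {2} z<s)) (update-same b j _)

  bⱼ₊₁ : b (1 + j) ≡ c (1 + j)
  bⱼ₊₁ = sym (trans (update-< b⁺ _ (n<1+n (1 + j))) (update-≢ b _ 1+n≢n))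

  bⱼ₊₂ : b (2 + j) ≡ c (2 + j) + 2
  bⱼ₊₂ = trans (sym (m∸n+n≡m bⱼ₊₂≥2)) (cong (_+ 2) (sym (update-same _ (2 + j) _)))

  fibSum-≡ : fibSum (5 + m) b ≡ fibSum (5 + m) c + fib (5 + m)
  fibSum-≡ = begin
    fibSum j b + b j * fib j + b (1 + j) * fib (1 + j) + b (2 + j) * fib (2 + j)
      ≡⟨ cong₂ _+_ (cong₂ _+_ (cong₂ _+_ (fibSum-cong j below) refl)
                              (cong (_* fib (1 + j)) bⱼ₊₁))
                   (cong (_* fib (2 + j)) bⱼ₊₂) ⟩
    fibSum j c + b j * fib j + c (1 + j) * fib (1 + j) + (c (2 + j) + 2) * fib (2 + j)
      ≡⟨ trade-two-for-one (fibSum j c) (b j) (c (1 + j)) (c (2 + j)) (fib j) (fib (1 + j)) ⟩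
    fibSum j c + (b j + 1) * fib j + c (1 + j) * fib (1 + j) + c (2 + j) * fib (2 + j) + fib (3 + j)
      ≡⟨ cong (λ x → fibSum j c + x * fib j + c (1 + j) * fib (1 + j) + c (2 + j) * fib (2 + j)
                     + fib (3 + j)) (sym cⱼ) ⟩
    fibSum (5 + m) c + fib (5 + m)
      ∎

  total-≡ : total (5 + m) b ≡ total (5 + m) c + 1
  total-≡ = begin
    total j b + b j + b (1 + j) + b (2 + j)
      ≡⟨ cong₂ _+_ (cong₂ _+_ (cong₂ _+_ (Σ₂-cong j below) refl) bⱼ₊₁) bⱼ₊₂ ⟩
    total j c + b j + c (1 + j) + (c (2 + j) + 2)
      ≡⟨ trade-two-for-one-count (total j c) (b j) (c (1 + j)) (c (2 + j)) ⟩
    total j c + (b j + 1) + c (1 + j) + c (2 + j) + 1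
      ≡⟨ cong (λ x → total j c + x + c (1 + j) + c (2 + j) + 1) (sym cⱼ) ⟩
    total (5 + m) c + 1
      ∎

reduction-double₄ : (b : ℕ → ℕ) → b 3 ≥ 2 → Reduction 4 b
reduction-double₄ b b₃≥2 = record
  { c = c ; fibSum-≡ = fibSum-≡ ; total-< = <-+-suc 0 total-≡ }
  where
  b⁺ = update b 2 (b 2 + 1)
  c = update b⁺ 3 (b 3 ∸ 2)

  c₂ : c 2 ≡ b 2 + 1
  c₂ = trans (update-< b⁺ (b 3 ∸ 2) (n<1+n 2)) (update-same b 2 _)

  b₃ : b 3 ≡ c 3 + 2
  b₃ = trans (sym (m∸n+n≡m b₃≥2)) (cong (_+ 2) (sym (update-same b⁺ 3 (b 3 ∸ 2))))

  fibSum-≡ : fibSum 4 b ≡ fibSum 4 c + fib 4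
  fibSum-≡ = begin
    0 + b 2 * 1 + b 3 * 2             ≡⟨ cong (λ y → b 2 * 1 + y * 2) b₃ ⟩
    b 2 * 1 + (c 3 + 2) * 2           ≡⟨ trade-two-for-one₄ (b 2) (c 3) ⟩
    (b 2 + 1) * 1 + c 3 * 2 + 3       ≡⟨ cong (λ x → x * 1 + c 3 * 2 + 3) (sym c₂) ⟩
    0 + c 2 * 1 + c 3 * 2 + 3         ∎

  total-≡ : total 4 b ≡ total 4 c + 1
  total-≡ = begin
    0 + b 2 + b 3                     ≡⟨ cong (b 2 +_) b₃ ⟩
    b 2 + (c 3 + 2)                   ≡⟨ trade-two-for-one₄-count (b 2) (c 3) ⟩
    (b 2 + 1) + c 3 + 1               ≡⟨ cong (λ x → x + c 3 + 1) (sym c₂) ⟩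
    0 + c 2 + c 3 + 1                 ∎

Reduction⇒Σ : ∀ {a b} → Reduction a b →
  Σ (ℕ → ℕ) (λ c → (fibSum a b ∸ fib a ≡ fibSum a c) × total a c < total a b)
Reduction⇒Σ {a} r = c , trans (cong (_∸ fib a) fibSum-≡) (m+n∸n≡m _ (fib a)) , total-<
  where open Reduction r

lemma14 : (a : ℕ) → a ≥ 4 → (b : ℕ → ℕ) →
            fibSum a b ≥ fib a →
            ((b (a ∸ 2) ≥ 1 × b (a ∸ 1) ≥ 1) ⊎ (b (a ∸ 2) ≡ 0 × b (a ∸ 1) ≥ 2)) →
            Σ (ℕ → ℕ) (λ c → (fibSum a b ∸ fib a ≡ fibSum a c) × total a c < total a b)
lemma14 (suc (suc (suc (suc m)))) (s≤s (s≤s (s≤s (s≤s _)))) b _ (inj₁ (bₐ₋₂≥1 , bₐ₋₁≥1)) =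
  Reduction⇒Σ (reduction-pair m b bₐ₋₂≥1 bₐ₋₁≥1)
lemma14 4 _ b _ (inj₂ (_ , b₃≥2)) =
  Reduction⇒Σ (reduction-double₄ b b₃≥2)
lemma14 (suc (suc (suc (suc (suc m))))) _ b _ (inj₂ (_ , bₐ₋₁≥2)) =
  Reduction⇒Σ (reduction-double m b bₐ₋₁≥2)
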